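{- Let $G$ be a semicomplete digraph and $l,w$ positive integers. Suppose $G$ has a $(2l,w)$-degree tangle $T$. Then $G$ has either a tame $(l,w)$-degree tangle or an $(l,w)$-spider.
   Context: Digraphs are simple; $G$ is semicomplete if between every two distinct vertices there is at least one edge. $N^\pm(v)$ are out-/in-neighborhoods, $d^+(v)=|N^+(v)|$; $V^+_{\le d}(G)$, $V^+_{\ge d}(G)$ are the sets of vertices with $d^+\le d$, resp. $d^+\ge d$. ${\rm wld}(v)=|V^+_{\le d^+(v)}(G)\setminus N^+(v)|$. ${\rm pw}(G)$ is the pathwidth, where a path-decomposition is a sequence of bags $(X_1,\dots,X_m)$ covering $V(G)$, with each vertex's bags forming an interval of indices, and for each edge $(u,v)$ some $i\ge j$ with $u\in X_i$, $v\in X_j$; width $\max|X_i|-1$. For integers $d\ge0,l>0,w>0$: a $(d,l,w)$-degree tangle is a set $T\subseteq V^+_{\ge d}(G)\cap V^+_{\le d+w}(G)$ with $|T|=l$, and an $(l,w)$-degree tangle is one for some $d$; an $(l,w)$-degree tangle $T$ is tame if ${\rm wld}(v)\le 3l+w+2{\rm pw}(G)$ for every $v\in T$. A $(d,l,w)$-spider is a triple $(T,L,R)$ with $|T|\ge l$, $L=\{L_v\}_{v\in T}$, $R=\{R_v\}_{v\in T}$ such that for each $v\in T$: $L_v\subseteq N^-(v)$, $|L_v|\ge 3l$, $d^+(u)\le d$ for all $u\in L_v$, $R_v\subseteq N^+(v)$, $|R_v|\ge 3l$, and $d^+(u)\ge d+w$ for all $u\in R_v$. An $(l,w)$-spider is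 a $(d,l,w)$-spider for some $d$. -}

module Defs where

open import Data.Bool using (Bool; true; false)
open import Data.Nat using (ℕ; suc; _+_; _*_; _≤_; _≤ᵇ_)
open import Data.Fin using (Fin; toℕ)
open import Data.Fin.Subset using (Subset; _∈_; _⊆_; _─_; ∣_∣)
open import Data.Vec using (tabulate)
open import Data.Product using (Σ; ∃; _×_)
open import Data.Sum using (_⊎_)
open import Relation.Binary.PropositionalEquality using (_≡_; _≢_)

record Digraph (n : ℕ) : Set where
  field
    adj   : Fin n → Fin n → Bool
    loopless : ∀ v → adj v v ≡ false
open Digraph public

module _ {n : ℕ} (G : Digraph n) where

  Semicomplete : Set
  Semicomplete = ∀ u v → u ≢ v → adj G u v ≡ true ⊎ adj G v u ≡ true

  N⁺ : Fin n → Subset n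
  N⁺ v = tabulate (λ u → adj G v u)

  N⁻ : Fin n → Subset n
  N⁻ v = tabulate (λ u → adj G u v)

  d⁺ : Fin n → ℕ
  d⁺ v = ∣ N⁺ v ∣

  V⁺≤ : ℕ → Subset n
  V⁺≤ d = tabulate (λ u → d⁺ u ≤ᵇ d)

  wld : Fin n → ℕ
  wld v = ∣ V⁺≤ (d⁺ v) ─ N⁺ v ∣

  record PathDecomposition : Set where
    field
      m    : ℕ
      bag  : Fin m → Subset n
      cover    : ∀ v → ∃ λ i → v ∈ bag i
      interval : ∀ v (i j k : Fin m) → toℕ i ≤ toℕ j → toℕ j ≤ toℕ k →
                 v ∈ bag i → v ∈ bag k → v ∈ bag j
      edges    : ∀ u v → adj G u v ≡ true →
                 ∃ λ i → ∃ λ j → toℕ j ≤ toℕ i × u ∈ bag i × v ∈ bag j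

  -- "D has width at most q", i.e. max_i |X_i| - 1 ≤ q
  WidthAtMost : PathDecomposition → ℕ → Set
  WidthAtMost D q = ∀ i → ∣ PathDecomposition.bag D i ∣ ≤ suc q

  IsPathwidth : ℕ → Set
  IsPathwidth p = (Σ PathDecomposition λ D → WidthAtMost D p)
                × (∀ (D : PathDecomposition) q → WidthAtMost D q → p ≤ q)

  DegreeTangle : ℕ → ℕ → ℕ → Subset n → Set
  DegreeTangle d l w T = ∣ T ∣ ≡ l × (∀ v → v ∈ T → d ≤ d⁺ v × d⁺ v ≤ d + w)

  LWDegreeTangle : ℕ → ℕ → Subset n → Set
  LWDegreeTangle l w T = ∃ λ d → DegreeTangle d l w T

  TameDegreeTangle : (pw : ℕ) → ℕ → ℕ → Subset n → Set
  TameDegreeTangle pw l w T =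
    LWDegreeTangle l w T × (∀ v → v ∈ T → wld v ≤ 3 * l + w + 2 * pw)

  -- (d,l,w)-spider (T, L, R); the families L, R are given for all vertices,
  -- only their values on T matter
  Spider : ℕ → ℕ → ℕ → Subset n → (Fin n → Subset n) → (Fin n → Subset n) → Set
  Spider d l w T L R =
    l ≤ ∣ T ∣ ×
    (∀ v → v ∈ T →
       (L v ⊆ N⁻ v × 3 * l ≤ ∣ L v ∣ × (∀ u → u ∈ L v → d⁺ u ≤ d)) ×
       (R v ⊆ N⁺ v × 3 * l ≤ ∣ R v ∣ × (∀ u → u ∈ R v → d + w ≤ d⁺ u)))

  HasLWSpider : ℕ → ℕ → Set
  HasLWSpider l w = ∃ λ d → ∃ λ T → ∃ λ L → ∃ λ R → Spider d l w T L R

-- Fix a path-decomposition of width pw. In a semicomplete digraph the out-degree classes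
-- are almost initial segments: |V⁺≤ x| ≤ x + pw + 1, because the vertex of V⁺≤ x whose
-- first bag comes last is an in-neighbour of no vertex of V⁺≤ x outside that bag; dually,
-- using last bags, d + 1 ≤ |V⁺≤ d| + pw. Hence the window V⁺≤ D ∖ V⁺≤ d has at most
-- (D − d) + 2pw vertices. For d⁺(v) = D ∈ [d, d + w], each vertex counted by wld(v) is v,
-- lies in the window, or is an in-neighbour of v of out-degree ≤ d, so
-- |L_v| ≥ wld(v) − w − 2pw − 1; and the vertices counted by wld(v) together with the
-- out-neighbours of v of out-degree ≤ d + w fit disjointly into V⁺≤ (d + w), so
-- |R_v| ≥ wld(v) − w − pw − 1. Among the 2l vertices of T, either l have
-- wld ≤ 3l + w + 2pw and form a tame tangle, or l exceed that bound and are the body of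
-- a spider with legs of size 3l.
module Submission where

open import Defs
open import Data.Bool using (Bool; true)
open import Data.Bool.Properties using (T-≡)
open import Data.Empty using (⊥-elim)
open import Data.Fin using (Fin; zero; suc; toℕ; _≟_)
open import Data.Fin.Subset
open import Data.Fin.Subset.Properties
open import Data.Nat using (ℕ; zero; suc; _+_; _*_; _≤_; _<_; _≤ᵇ_; _≤?_; z≤n; s≤s; s≤s⁻¹)
open import Data.Nat.Properties
  using ( ≤-reflexive; ≤-trans; ≤-total; <⇒≤; ≰⇒>; n≤1+n; m≤m+n; ≤ᵇ⇒≤; ≤⇒≤ᵇ
        ; +-comm; +-assoc; +-suc; +-identityʳ; +-mono-≤; +-monoˡ-≤; +-monoʳ-≤
        ; +-cancelˡ-≤; +-cancelʳ-≤; module ≤-Reasoning )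
open import Data.Nat.Tactic.RingSolver using (solve-∀)
open import Data.Product using (∃; ∃-syntax; _×_; _,_; proj₁; proj₂; uncurry)
open import Data.Sum using (_⊎_; inj₁; inj₂; [_,_]′)
import Data.Sum as Sum
open import Data.Vec using ([]; _∷_; here; there; tabulate)
open import Data.Vec.Properties using (lookup∘tabulate; lookup⇒[]=; []=⇒lookup)
open import Function using (_∘_; id; flip)
open import Function.Bundles using (Equivalence)
open import Relation.Binary.Core using (Rel)
open import Relation.Binary.Definitions using (Total; Transitive)
open import Relation.Binary.PropositionalEquality
  using (_≡_; refl; sym; trans; cong; subst; module ≡-Reasoning)
open import Relation.Nullary using (¬_; yes; no; ¬?)
open import Relation.Nullary.Decidable using (decidable-stable)
open import Relation.Unary using (Pred; Decidable)

private variable n : ℕ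

∈-tabulate⁺ : ∀ {f : Fin n → Bool} {x} → f x ≡ true → x ∈ tabulate f
∈-tabulate⁺ {f = f} {x} fx = lookup⇒[]= x (tabulate f) (trans (lookup∘tabulate f x) fx)

∈-tabulate⁻ : ∀ {f : Fin n → Bool} {x} → x ∈ tabulate f → f x ≡ true
∈-tabulate⁻ {f = f} {x} x∈ = trans (sym (lookup∘tabulate f x)) ([]=⇒lookup x∈)

x∈p─q⁻ : ∀ {x} (p q : Subset n) → x ∈ p ─ q → x ∈ p × x ∉ q
x∈p─q⁻ (inside ∷ p) (outside ∷ q) here = here , λ ()
x∈p─q⁻ {x = zero} (_ ∷ p) (inside ∷ q) ()
x∈p─q⁻ {x = zero} (outside ∷ p) (outside ∷ q) ()
x∈p─q⁻ (s ∷ p) (t ∷ q) (there x∈p─q) with x∈p─q⁻ p q x∈p─q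
... | x∈p , x∉q = there x∈p , λ { (there x∈q) → x∉q x∈q }

∣p∪q∣≤∣p∣+∣q∣ : ∀ (p q : Subset n) → ∣ p ∪ q ∣ ≤ ∣ p ∣ + ∣ q ∣
∣p∪q∣≤∣p∣+∣q∣ [] [] = z≤n
∣p∪q∣≤∣p∣+∣q∣ (outside ∷ p) (outside ∷ q) = ∣p∪q∣≤∣p∣+∣q∣ p q
∣p∪q∣≤∣p∣+∣q∣ (outside ∷ p) (inside ∷ q) =
  subst (suc ∣ p ∪ q ∣ ≤_) (sym (+-suc ∣ p ∣ ∣ q ∣)) (s≤s (∣p∪q∣≤∣p∣+∣q∣ p q))
∣p∪q∣≤∣p∣+∣q∣ (inside ∷ p) (outside ∷ q) = s≤s (∣p∪q∣≤∣p∣+∣q∣ p q)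
∣p∪q∣≤∣p∣+∣q∣ (inside ∷ p) (inside ∷ q) =
  s≤s (≤-trans (∣p∪q∣≤∣p∣+∣q∣ p q) (+-monoʳ-≤ ∣ p ∣ (n≤1+n ∣ q ∣)))

∣p∪q∣≡∣p∣+∣q∣ : ∀ (p q : Subset n) → Empty (p ∩ q) → ∣ p ∪ q ∣ ≡ ∣ p ∣ + ∣ q ∣
∣p∪q∣≡∣p∣+∣q∣ [] [] _ = refl
∣p∪q∣≡∣p∣+∣q∣ (outside ∷ p) (outside ∷ q) e = ∣p∪q∣≡∣p∣+∣q∣ p q (drop-∷-Empty e)
∣p∪q∣≡∣p∣+∣q∣ (outside ∷ p) (inside ∷ q) e =
  trans (cong suc (∣p∪q∣≡∣p∣+∣q∣ p q (drop-∷-Empty e))) (sym (+-suc ∣ p ∣ ∣ q ∣))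
∣p∪q∣≡∣p∣+∣q∣ (inside ∷ p) (outside ∷ q) e = cong suc (∣p∪q∣≡∣p∣+∣q∣ p q (drop-∷-Empty e))
∣p∪q∣≡∣p∣+∣q∣ (inside ∷ p) (inside ∷ q) e = ⊥-elim (e (zero , here))

∣p∣≤∣p∩q∣+∣p─q∣ : ∀ (p q : Subset n) → ∣ p ∣ ≤ ∣ p ∩ q ∣ + ∣ p ─ q ∣
∣p∣≤∣p∩q∣+∣p─q∣ p q = ≤-trans (p⊆q⇒∣p∣≤∣q∣ split) (∣p∪q∣≤∣p∣+∣q∣ (p ∩ q) (p ─ q))
  where
  split : p ⊆ p ∩ q ∪ (p ─ q)
  split {x} x∈p with x ∈? q
  ... | yes x∈q = x∈p∪q⁺ (inj₁ (x∈p∩q⁺ (x∈p , x∈q)))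
  ... | no  x∉q = x∈p∪q⁺ (inj₂ (x∈p∧x∉q⇒x∈p─q x∈p x∉q))

subset-of-size : ∀ {k} (p : Subset n) → k ≤ ∣ p ∣ → ∃[ q ] (q ⊆ p × ∣ q ∣ ≡ k)
subset-of-size {n} {zero} p _ = ⊥ , (λ x∈⊥ → ⊥-elim (∉⊥ x∈⊥)) , ∣⊥∣≡0 n
subset-of-size {k = suc k} (inside ∷ p) (s≤s k≤∣p∣) with subset-of-size p k≤∣p∣
... | q , q⊆p , ∣q∣≡k =
  inside ∷ q , (λ { here → here ; (there x∈q) → there (q⊆p x∈q) }) , cong suc ∣q∣≡k
subset-of-size {k = suc k} (outside ∷ p) k≤∣p∣ with subset-of-size p k≤∣p∣
... | q , q⊆p , ∣q∣≡k = outside ∷ q , (λ { (there x∈q) → there (q⊆p x∈q) }) , ∣q∣≡k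

module _ {a r} {A : Set a} {_≼_ : Rel A r} (total : Total _≼_) (trans≼ : Transitive _≼_) where

  refl≼ : ∀ x → x ≼ x
  refl≼ x = [ id , id ]′ (total x x)

  empty⊎maximum : ∀ {n p} {P : Pred (Fin n) p} → Decidable P → (f : Fin n → A) →
                  (∀ i → ¬ P i) ⊎ ∃[ u ] (P u × ∀ {i} → P i → f i ≼ f u)
  empty⊎maximum {zero} P? f = inj₁ λ ()
  empty⊎maximum {suc n} P? f with P? zero | empty⊎maximum (P? ∘ suc) (f ∘ suc)
  ... | no ¬P0 | inj₁ none = inj₁ λ { zero → ¬P0 ; (suc i) → none i }
  ... | no ¬P0 | inj₂ (u , Pu , max) =
    inj₂ (suc u , Pu , λ { {zero} P0 → ⊥-elim (¬P0 P0) ; {suc i} → max })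
  ... | yes P0 | inj₁ none =
    inj₂ (zero , P0 , λ { {zero} _ → refl≼ (f zero) ; {suc i} Pi → ⊥-elim (none i Pi) })
  ... | yes P0 | inj₂ (u , Pu , max) with total (f (suc u)) (f zero)
  ...   | inj₁ u≼0 =
    inj₂ (zero , P0 , λ { {zero} _ → refl≼ (f zero) ; {suc i} Pi → trans≼ (max Pi) u≼0 })
  ...   | inj₂ 0≼u = inj₂ (suc u , Pu , λ { {zero} _ → 0≼u ; {suc i} → max })

  maximum : ∀ {n p} {P : Pred (Fin n) p} → Decidable P → (f : Fin n → A) →
            ∃ P → ∃[ u ] (P u × ∀ {i} → P i → f i ≼ f u)
  maximum P? f (i , Pi) with empty⊎maximum P? f
  ... | inj₁ none = ⊥-elim (none i Pi)
  ... | inj₂ max  = max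

≤⇒≤ᵇ≡true : ∀ {m n} → m ≤ n → (m ≤ᵇ n) ≡ true
≤⇒≤ᵇ≡true = Equivalence.to T-≡ ∘ ≤⇒≤ᵇ

≤ᵇ≡true⇒≤ : ∀ {m n} → (m ≤ᵇ n) ≡ true → m ≤ n
≤ᵇ≡true⇒≤ = ≤ᵇ⇒≤ _ _ ∘ Equivalence.from T-≡

m+n<o≤p+1+n⇒m≤p : ∀ {m n o p} → m + n < o → o ≤ p + suc n → m ≤ p
m+n<o≤p+1+n⇒m≤p {m} {n} m+n<o o≤p+1+n =
  +-cancelʳ-≤ (suc n) m _ (≤-trans (≤-reflexive (+-suc m n)) (≤-trans m+n<o o≤p+1+n))

m+m≤n+o⇒m≤n⊎m≤o : ∀ {m n o} → m + m ≤ n + o → m ≤ n ⊎ m ≤ o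
m+m≤n+o⇒m≤n⊎m≤o {m} {n} {o} m+m≤n+o with m ≤? n
... | yes m≤n = inj₁ m≤n
... | no  m≰n = inj₂ (+-cancelˡ-≤ m m o (≤-trans m+m≤n+o (+-monoˡ-≤ o (<⇒≤ (≰⇒> m≰n)))))

module _ (G : Digraph n) where

  V⁺≥ : ℕ → Subset n
  V⁺≥ d = tabulate (λ u → d ≤ᵇ d⁺ G u)

  Wld≤ : ℕ → Subset n
  Wld≤ k = tabulate (λ u → wld G u ≤ᵇ k)

  ∈V⁺≤⁺ : ∀ {x u} → d⁺ G u ≤ x → u ∈ V⁺≤ G x
  ∈V⁺≤⁺ = ∈-tabulate⁺ ∘ ≤⇒≤ᵇ≡true

  ∈V⁺≤⁻ : ∀ {x u} → u ∈ V⁺≤ G x → d⁺ G u ≤ x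
  ∈V⁺≤⁻ = ≤ᵇ≡true⇒≤ ∘ ∈-tabulate⁻

  ∈V⁺≥⁺ : ∀ {x u} → x ≤ d⁺ G u → u ∈ V⁺≥ x
  ∈V⁺≥⁺ = ∈-tabulate⁺ ∘ ≤⇒≤ᵇ≡true

  ∈V⁺≥⁻ : ∀ {x u} → u ∈ V⁺≥ x → x ≤ d⁺ G u
  ∈V⁺≥⁻ = ≤ᵇ≡true⇒≤ ∘ ∈-tabulate⁻

  ∈Wld≤⁺ : ∀ {k u} → wld G u ≤ k → u ∈ Wld≤ k
  ∈Wld≤⁺ = ∈-tabulate⁺ ∘ ≤⇒≤ᵇ≡true

  ∈Wld≤⁻ : ∀ {k u} → u ∈ Wld≤ k → wld G u ≤ k
  ∈Wld≤⁻ = ≤ᵇ≡true⇒≤ ∘ ∈-tabulate⁻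

  ∣N⁺∪⁅v⁆∣≡1+d⁺ : ∀ v → ∣ N⁺ G v ∪ ⁅ v ⁆ ∣ ≡ suc (d⁺ G v)
  ∣N⁺∪⁅v⁆∣≡1+d⁺ v = begin
    ∣ N⁺ G v ∪ ⁅ v ⁆ ∣    ≡⟨ ∣p∪q∣≡∣p∣+∣q∣ (N⁺ G v) ⁅ v ⁆ v∉N⁺v ⟩
    d⁺ G v + ∣ ⁅ v ⁆ ∣    ≡⟨ cong (d⁺ G v +_) (∣⁅x⁆∣≡1 v) ⟩
    d⁺ G v + 1            ≡⟨ +-comm (d⁺ G v) 1 ⟩
    suc (d⁺ G v)          ∎
    where
    open ≡-Reasoning
    v∉N⁺v : Empty (N⁺ G v ∩ ⁅ v ⁆)
    v∉N⁺v (u , u∈) with x∈p∩q⁻ (N⁺ G v) ⁅ v ⁆ u∈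
    ... | u∈N⁺ , u∈⁅v⁆ with x∈⁅y⁆⇒x≡y v u∈⁅v⁆
    ... | refl with trans (sym (∈-tabulate⁻ u∈N⁺)) (loopless G v)
    ... | ()

  d⁺<n : ∀ v → d⁺ G v < n
  d⁺<n v = ≤-trans (≤-reflexive (sym (∣N⁺∪⁅v⁆∣≡1+d⁺ v))) (∣p∣≤n (N⁺ G v ∪ ⁅ v ⁆))

  module _ (D : PathDecomposition G) where
    open PathDecomposition D

    first-bag : ∀ v → ∃[ i ] (v ∈ bag i × ∀ {j} → v ∈ bag j → toℕ i ≤ toℕ j)
    first-bag v = maximum (flip ≤-total) (flip ≤-trans) (λ i → v ∈? bag i) toℕ (cover v)

    last-bag : ∀ v → ∃[ i ] (v ∈ bag i × ∀ {j} → v ∈ bag j → toℕ j ≤ toℕ i)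
    last-bag v = maximum ≤-total ≤-trans (λ i → v ∈? bag i) toℕ (cover v)

    first last : Fin n → Fin m
    first = proj₁ ∘ first-bag
    last  = proj₁ ∘ last-bag

    ∈-first : ∀ v → v ∈ bag (first v)
    ∈-first = proj₁ ∘ proj₂ ∘ first-bag

    ∈-last : ∀ v → v ∈ bag (last v)
    ∈-last = proj₁ ∘ proj₂ ∘ last-bag

    edge⇒∈bag-first : ∀ {y u} → adj G y u ≡ true → toℕ (first y) ≤ toℕ (first u) →
                      y ∈ bag (first u)
    edge⇒∈bag-first {y} {u} yu fy≤fu with edges y u yu
    ... | a , b , b≤a , y∈a , u∈b = interval y (first y) (first u) a
      fy≤fu (≤-trans (proj₂ (proj₂ (first-bag u)) u∈b) b≤a) (∈-first y) y∈a

    edge⇒∈bag-last : ∀ {u y} → adj G u y ≡ true → toℕ (last u) ≤ toℕ (last y) →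
                     y ∈ bag (last u)
    edge⇒∈bag-last {u} {y} uy lu≤ly with edges u y uy
    ... | a , b , b≤a , u∈a , y∈b = interval y b (last u) (last y)
      (≤-trans b≤a (proj₂ (proj₂ (last-bag u)) u∈a)) lu≤ly y∈b (∈-last y)

    module _ {pw} (width : WidthAtMost G D pw) where

      ∣V⁺≤∣≤ : Semicomplete G → ∀ x → ∣ V⁺≤ G x ∣ ≤ x + suc pw
      ∣V⁺≤∣≤ sc x with empty⊎maximum ≤-total ≤-trans (_∈? V⁺≤ G x) (toℕ ∘ first)
      ... | inj₁ none = begin
        ∣ V⁺≤ G x ∣  ≡⟨ cong ∣_∣ (Empty-unique {p = V⁺≤ G x} (λ (y , y∈) → none y y∈)) ⟩
        ∣ ⊥ {n} ∣    ≡⟨ ∣⊥∣≡0 n ⟩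
        0            ≤⟨ z≤n ⟩
        x + suc pw   ∎
        where open ≤-Reasoning
      ... | inj₂ (u , u∈V⁺≤ , latest) = begin
        ∣ V⁺≤ G x ∣                    ≤⟨ p⊆q⇒∣p∣≤∣q∣ dominated ⟩
        ∣ N⁺ G u ∪ bag (first u) ∣     ≤⟨ ∣p∪q∣≤∣p∣+∣q∣ (N⁺ G u) (bag (first u)) ⟩
        d⁺ G u + ∣ bag (first u) ∣     ≤⟨ +-mono-≤ (∈V⁺≤⁻ u∈V⁺≤) (width (first u)) ⟩
        x + suc pw                     ∎
        where
        open ≤-Reasoning
        dominated : V⁺≤ G x ⊆ N⁺ G u ∪ bag (first u)
        dominated {y} y∈V⁺≤ with y ∈? bag (first u)
        ... | yes y∈bag = x∈p∪q⁺ (inj₂ y∈bag)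
        ... | no  y∉bag with sc u y (λ { refl → y∉bag (∈-first u) })
        ...   | inj₁ uy = x∈p∪q⁺ (inj₁ (∈-tabulate⁺ uy))
        ...   | inj₂ yu = ⊥-elim (y∉bag (edge⇒∈bag-first yu (latest y∈V⁺≤)))

      ≤∣V⁺≤∣ : ∀ {d} → d < n → suc d ≤ ∣ V⁺≤ G d ∣ + pw
      ≤∣V⁺≤∣ {d} d<n
        with empty⊎maximum (flip ≤-total) (flip ≤-trans) (λ y → ¬? (y ∈? V⁺≤ G d)) (toℕ ∘ last)
      ... | inj₁ none = begin
        suc d               ≤⟨ d<n ⟩
        n                   ≡⟨ ∣⊤∣≡n n ⟨
        ∣ ⊤ {n} ∣           ≤⟨ p⊆q⇒∣p∣≤∣q∣ {p = ⊤} (λ {y} _ → decidable-stable (y ∈? _) (none y)) ⟩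
        ∣ V⁺≤ G d ∣         ≤⟨ m≤m+n _ pw ⟩
        ∣ V⁺≤ G d ∣ + pw    ∎
        where open ≤-Reasoning
      ... | inj₂ (u , u∉V⁺≤ , earliest) = s≤s⁻¹ (begin
        suc (suc d)                    ≤⟨ s≤s (≰⇒> (u∉V⁺≤ ∘ ∈V⁺≤⁺)) ⟩
        suc (d⁺ G u)                   ≡⟨ ∣N⁺∪⁅v⁆∣≡1+d⁺ u ⟨
        ∣ N⁺ G u ∪ ⁅ u ⁆ ∣             ≤⟨ p⊆q⇒∣p∣≤∣q∣ dominated ⟩
        ∣ V⁺≤ G d ∪ bag (last u) ∣     ≤⟨ ∣p∪q∣≤∣p∣+∣q∣ (V⁺≤ G d) (bag (last u)) ⟩
        ∣ V⁺≤ G d ∣ + ∣ bag (last u) ∣ ≤⟨ +-monoʳ-≤ _ (width (last u)) ⟩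
        ∣ V⁺≤ G d ∣ + suc pw           ≡⟨ +-suc _ pw ⟩
        suc (∣ V⁺≤ G d ∣ + pw)         ∎)
        where
        open ≤-Reasoning
        dominated : N⁺ G u ∪ ⁅ u ⁆ ⊆ V⁺≤ G d ∪ bag (last u)
        dominated {y} y∈ with x∈p∪q⁻ (N⁺ G u) ⁅ u ⁆ y∈
        ... | inj₂ y∈⁅u⁆ rewrite x∈⁅y⁆⇒x≡y u y∈⁅u⁆ = x∈p∪q⁺ (inj₂ (∈-last u))
        ... | inj₁ y∈N⁺ with y ∈? V⁺≤ G d
        ...   | yes y∈V⁺≤ = x∈p∪q⁺ (inj₁ y∈V⁺≤)
        ...   | no  y∉V⁺≤ =
          x∈p∪q⁺ (inj₂ (edge⇒∈bag-last (∈-tabulate⁻ y∈N⁺) (earliest y∉V⁺≤)))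

      ∣V⁺≤─V⁺≤∣+d≤ : Semicomplete G → ∀ {d D} → d ≤ D → d < n →
                     ∣ V⁺≤ G D ─ V⁺≤ G d ∣ + d ≤ D + 2 * pw
      ∣V⁺≤─V⁺≤∣+d≤ sc {d} {D} d≤D d<n = s≤s⁻¹ (begin
        suc (window + d)                   ≡⟨ +-suc window d ⟨
        window + suc d                     ≤⟨ +-monoʳ-≤ window (≤∣V⁺≤∣ d<n) ⟩
        window + (∣ V⁺≤ G d ∣ + pw)        ≡⟨ +-assoc window _ pw ⟨
        window + ∣ V⁺≤ G d ∣ + pw          ≤⟨ +-monoˡ-≤ pw window+∣V⁺≤∣≤ ⟩
        D + suc pw + pw                    ≡⟨ rearrange D pw ⟩
        suc (D + 2 * pw)                   ∎)
        where
        open ≤-Reasoning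
        window : ℕ
        window = ∣ V⁺≤ G D ─ V⁺≤ G d ∣
        rearrange : ∀ D pw → D + suc pw + pw ≡ suc (D + 2 * pw)
        rearrange = solve-∀
        disjoint : Empty ((V⁺≤ G D ─ V⁺≤ G d) ∩ V⁺≤ G d)
        disjoint (y , y∈) with x∈p∩q⁻ (V⁺≤ G D ─ V⁺≤ G d) (V⁺≤ G d) y∈
        ... | y∈─ , y∈V⁺≤ = proj₂ (x∈p─q⁻ (V⁺≤ G D) (V⁺≤ G d) y∈─) y∈V⁺≤
        ⊆V⁺≤D : (V⁺≤ G D ─ V⁺≤ G d) ∪ V⁺≤ G d ⊆ V⁺≤ G D
        ⊆V⁺≤D y∈ with x∈p∪q⁻ (V⁺≤ G D ─ V⁺≤ G d) (V⁺≤ G d) y∈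
        ... | inj₁ y∈─   = p─q⊆p (V⁺≤ G D) (V⁺≤ G d) y∈─
        ... | inj₂ y∈V⁺≤ = ∈V⁺≤⁺ (≤-trans (∈V⁺≤⁻ y∈V⁺≤) d≤D)
        window+∣V⁺≤∣≤ : window + ∣ V⁺≤ G d ∣ ≤ D + suc pw
        window+∣V⁺≤∣≤ = begin
          window + ∣ V⁺≤ G d ∣                     ≡⟨ ∣p∪q∣≡∣p∣+∣q∣ _ (V⁺≤ G d) disjoint ⟨
          ∣ (V⁺≤ G D ─ V⁺≤ G d) ∪ V⁺≤ G d ∣        ≤⟨ p⊆q⇒∣p∣≤∣q∣ ⊆V⁺≤D ⟩
          ∣ V⁺≤ G D ∣                              ≤⟨ ∣V⁺≤∣≤ sc D ⟩
          D + suc pw                               ∎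

      module _ (sc : Semicomplete G) {d w v} (d≤d⁺v : d ≤ d⁺ G v) (d⁺v≤d+w : d⁺ G v ≤ d + w) where

        wld-set : Subset n
        wld-set = V⁺≤ G (d⁺ G v) ─ N⁺ G v

        wld≤∣L∣+ : wld G v ≤ ∣ V⁺≤ G d ∩ N⁻ G v ∣ + suc (w + 2 * pw)
        wld≤∣L∣+ = begin
          ∣ wld-set ∣                        ≤⟨ p⊆q⇒∣p∣≤∣q∣ split ⟩
          ∣ L ∪ (⁅ v ⁆ ∪ window) ∣           ≤⟨ ∣p∪q∣≤∣p∣+∣q∣ L (⁅ v ⁆ ∪ window) ⟩
          ∣ L ∣ + ∣ ⁅ v ⁆ ∪ window ∣         ≤⟨ +-monoʳ-≤ ∣ L ∣ (∣p∪q∣≤∣p∣+∣q∣ ⁅ v ⁆ window) ⟩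
          ∣ L ∣ + (∣ ⁅ v ⁆ ∣ + ∣ window ∣)   ≡⟨ cong (λ k → ∣ L ∣ + (k + ∣ window ∣)) (∣⁅x⁆∣≡1 v) ⟩
          ∣ L ∣ + suc ∣ window ∣             ≤⟨ +-monoʳ-≤ ∣ L ∣ (s≤s ∣window∣≤) ⟩
          ∣ L ∣ + suc (w + 2 * pw)           ∎
          where
          open ≤-Reasoning
          L window : Subset n
          L = V⁺≤ G d ∩ N⁻ G v
          window = V⁺≤ G (d⁺ G v) ─ V⁺≤ G d
          split : wld-set ⊆ L ∪ (⁅ v ⁆ ∪ window)
          split {y} y∈ with x∈p─q⁻ (V⁺≤ G (d⁺ G v)) (N⁺ G v) y∈ | y ≟ v
          ... | _ , _ | yes refl = x∈p∪q⁺ (inj₂ (x∈p∪q⁺ (inj₁ (x∈⁅x⁆ v))))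
          ... | y∈V⁺≤ , y∉N⁺ | no y≢v with sc y v y≢v | y ∈? V⁺≤ G d
          ...   | inj₂ vy | _ = ⊥-elim (y∉N⁺ (∈-tabulate⁺ vy))
          ...   | inj₁ yv | yes y∈V⁺≤d = x∈p∪q⁺ (inj₁ (x∈p∩q⁺ (y∈V⁺≤d , ∈-tabulate⁺ yv)))
          ...   | inj₁ yv | no  y∉V⁺≤d =
            x∈p∪q⁺ (inj₂ (x∈p∪q⁺ (inj₂ (x∈p∧x∉q⇒x∈p─q y∈V⁺≤ y∉V⁺≤d))))
          ∣window∣≤ : ∣ window ∣ ≤ w + 2 * pw
          ∣window∣≤ = +-cancelʳ-≤ d _ _ (begin
            ∣ window ∣ + d      ≤⟨ ∣V⁺≤─V⁺≤∣+d≤ sc d≤d⁺v (≤-trans (s≤s d≤d⁺v) (d⁺<n v)) ⟩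
            d⁺ G v + 2 * pw     ≤⟨ +-monoˡ-≤ (2 * pw) d⁺v≤d+w ⟩
            d + w + 2 * pw      ≡⟨ rearrange d w (2 * pw) ⟩
            w + 2 * pw + d      ∎)
            where
            rearrange : ∀ d w p → d + w + p ≡ w + p + d
            rearrange = solve-∀

        wld≤∣R∣+ : wld G v ≤ ∣ N⁺ G v ∩ V⁺≥ (d + w) ∣ + suc (w + pw)
        wld≤∣R∣+ = +-cancelˡ-≤ d _ _ (begin
          d + wld G v                     ≤⟨ +-monoˡ-≤ (wld G v) d≤d⁺v ⟩
          d⁺ G v + wld G v                ≤⟨ +-monoˡ-≤ (wld G v) d⁺v≤∣R∣+∣X∣ ⟩
          ∣ R ∣ + ∣ X ∣ + wld G v         ≡⟨ +-assoc ∣ R ∣ ∣ X ∣ (wld G v) ⟩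
          ∣ R ∣ + (∣ X ∣ + ∣ wld-set ∣)   ≡⟨ cong (∣ R ∣ +_) (∣p∪q∣≡∣p∣+∣q∣ X wld-set disjoint) ⟨
          ∣ R ∣ + ∣ X ∪ wld-set ∣         ≤⟨ +-monoʳ-≤ ∣ R ∣ (p⊆q⇒∣p∣≤∣q∣ ⊆V⁺≤) ⟩
          ∣ R ∣ + ∣ V⁺≤ G (d + w) ∣       ≤⟨ +-monoʳ-≤ ∣ R ∣ (∣V⁺≤∣≤ sc (d + w)) ⟩
          ∣ R ∣ + (d + w + suc pw)        ≡⟨ rearrange ∣ R ∣ d w pw ⟩
          d + (∣ R ∣ + suc (w + pw))      ∎)
          where
          open ≤-Reasoning
          R X : Subset n
          R = N⁺ G v ∩ V⁺≥ (d + w)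
          X = N⁺ G v ∩ V⁺≤ G (d + w)
          rearrange : ∀ r d w p → r + (d + w + suc p) ≡ d + (r + suc (w + p))
          rearrange = solve-∀
          N⁺⊆ : N⁺ G v ⊆ R ∪ X
          N⁺⊆ {y} y∈N⁺ with d + w ≤? d⁺ G y
          ... | yes d+w≤ = x∈p∪q⁺ (inj₁ (x∈p∩q⁺ (y∈N⁺ , ∈V⁺≥⁺ d+w≤)))
          ... | no  d+w≰ = x∈p∪q⁺ (inj₂ (x∈p∩q⁺ (y∈N⁺ , ∈V⁺≤⁺ (<⇒≤ (≰⇒> d+w≰)))))
          d⁺v≤∣R∣+∣X∣ : d⁺ G v ≤ ∣ R ∣ + ∣ X ∣
          d⁺v≤∣R∣+∣X∣ = ≤-trans (p⊆q⇒∣p∣≤∣q∣ N⁺⊆) (∣p∪q∣≤∣p∣+∣q∣ R X)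
          disjoint : Empty (X ∩ wld-set)
          disjoint (y , y∈) with x∈p∩q⁻ X wld-set y∈
          ... | y∈X , y∈W =
            proj₂ (x∈p─q⁻ (V⁺≤ G (d⁺ G v)) (N⁺ G v) y∈W) (proj₁ (x∈p∩q⁻ (N⁺ G v) _ y∈X))
          ⊆V⁺≤ : X ∪ wld-set ⊆ V⁺≤ G (d + w)
          ⊆V⁺≤ y∈ with x∈p∪q⁻ X wld-set y∈
          ... | inj₁ y∈X = proj₂ (x∈p∩q⁻ (N⁺ G v) _ y∈X)
          ... | inj₂ y∈W = ∈V⁺≤⁺ (≤-trans (∈V⁺≤⁻ (p─q⊆p _ (N⁺ G v) y∈W)) d⁺v≤d+w)

      wild-spider : Semicomplete G → ∀ {l w d} (S : Subset n) → l ≤ ∣ S ∣ →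
                    (∀ v → v ∈ S → d ≤ d⁺ G v × d⁺ G v ≤ d + w) →
                    (∀ {v} → v ∈ S → 3 * l + w + 2 * pw < wld G v) →
                    Spider G d l w S (λ v → V⁺≤ G d ∩ N⁻ G v) (λ v → N⁺ G v ∩ V⁺≥ (d + w))
      wild-spider sc {l} {w} {d} S l≤∣S∣ S-deg S-wild = l≤∣S∣ , λ v v∈S →
          ( p∩q⊆q (V⁺≤ G d) (N⁻ G v)
          , ∣L∣≥ v∈S
          , λ u → ∈V⁺≤⁻ ∘ p∩q⊆p (V⁺≤ G d) (N⁻ G v) )
        , ( p∩q⊆p (N⁺ G v) (V⁺≥ (d + w))
          , ∣R∣≥ v∈S
          , λ u → ∈V⁺≥⁻ ∘ p∩q⊆q (N⁺ G v) (V⁺≥ (d + w)) )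
        where
        wld-large : ∀ {v} → v ∈ S → 3 * l + (w + 2 * pw) < wld G v
        wld-large {v} v∈S = subst (_< wld G v) (+-assoc (3 * l) w (2 * pw)) (S-wild v∈S)
        ∣L∣≥ : ∀ {v} → v ∈ S → 3 * l ≤ ∣ V⁺≤ G d ∩ N⁻ G v ∣
        ∣L∣≥ {v} v∈S = m+n<o≤p+1+n⇒m≤p (wld-large v∈S) (uncurry (wld≤∣L∣+ sc) (S-deg v v∈S))
        ∣R∣≥ : ∀ {v} → v ∈ S → 3 * l ≤ ∣ N⁺ G v ∩ V⁺≥ (d + w) ∣
        ∣R∣≥ {v} v∈S = m+n<o≤p+1+n⇒m≤p (wld-large v∈S)
          (≤-trans (uncurry (wld≤∣R∣+ sc) (S-deg v v∈S)) (+-monoʳ-≤ _ (s≤s pw≤2pw)))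
          where
          pw≤2pw : w + pw ≤ w + 2 * pw
          pw≤2pw = +-monoʳ-≤ w (m≤m+n pw (pw + 0))

  tame-subtangle : ∀ {pw l w d} (T : Subset n) →
                   (∀ v → v ∈ T → d ≤ d⁺ G v × d⁺ G v ≤ d + w) →
                   l ≤ ∣ T ∩ Wld≤ (3 * l + w + 2 * pw) ∣ →
                   ∃ λ T′ → TameDegreeTangle G pw l w T′
  tame-subtangle {pw} {l} {w} {d} T T-deg l≤
    with subset-of-size (T ∩ Wld≤ (3 * l + w + 2 * pw)) l≤
  ... | T′ , T′⊆ , ∣T′∣≡l =
    T′ , (d , ∣T′∣≡l , λ v → T-deg v ∘ p∩q⊆p T _ ∘ T′⊆) , λ v → ∈Wld≤⁻ ∘ p∩q⊆q T _ ∘ T′⊆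

lemma14 : ∀ {n : ℕ} (G : Digraph n) → Semicomplete G →
          (l w : ℕ) → 1 ≤ l → 1 ≤ w →
          (T : Subset n) → LWDegreeTangle G (2 * l) w T →
          (pw : ℕ) → IsPathwidth G pw →
          (∃ λ T′ → TameDegreeTangle G pw l w T′) ⊎ HasLWSpider G l w
lemma14 G sc l w _ _ T (d , ∣T∣≡2l , T-deg) pw ((D , width) , _) =
  Sum.map (tame-subtangle G {pw} T T-deg)
          (λ l≤∣wild∣ → d , wild , _ , _ ,
             wild-spider G D width sc wild l≤∣wild∣ (λ v → T-deg v ∘ p─q⊆p T tame) wild-wld)
          (m+m≤n+o⇒m≤n⊎m≤o (begin
            l + l                              ≡⟨ cong (l +_) (+-identityʳ l) ⟨
            2 * l                              ≡⟨ ∣T∣≡2l ⟨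
            ∣ T ∣                              ≤⟨ ∣p∣≤∣p∩q∣+∣p─q∣ T tame ⟩
            ∣ T ∩ tame ∣ + ∣ T ─ tame ∣        ∎))
  where
  open ≤-Reasoning
  tame wild : Subset _
  tame = Wld≤ G (3 * l + w + 2 * pw)
  wild = T ─ tame
  wild-wld : ∀ {v} → v ∈ wild → 3 * l + w + 2 * pw < wld G v
  wild-wld v∈ = ≰⇒> (proj₂ (x∈p─q⁻ T tame v∈) ∘ ∈Wld≤⁺ G)
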